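{- Let $t,u$ be vsub$_k$-terms and $d\colon t\to_{\mathsf{vsub}_k}^* u$. Then there is a derivation $e\colon t^{\circ}\to_{\mathsf{vseq}}^* u^{\circ}$ such that: (1) $|d|_{\mathtt m}=|e|_{\bar\lambda}$; (2) $|d|_{\mathtt e}=|e|_{\tilde\mu}$, and hence $|d|=|e|$; (3) if $u$ is $\mathsf{vsub}_k$-normal then $u^{\circ}$ is $\mathsf{vseq}$-normal.
   Context: Vsub$_k$-terms: $t,u::= v\mid tv\mid t[x\leftarrow u]$, values $v::=x\mid\lambda x.t$, where $t[x\leftarrow u]$ binds $x$ in $t$; up to $\alpha$; $t\{x\leftarrow v\}$ capture-avoiding substitution. Evaluation contexts $E::=\langle\cdot\rangle\mid Ev\mid E[x\leftarrow u]\mid t[x\leftarrow E]$; substitution contexts $L::=\langle\cdot\rangle\mid L[x\leftarrow u]$. $\to_{\mathtt m}$ is the closure under evaluation contexts of $L\langle\lambda x.t\rangle v\mapsto L\langle t[x\leftarrow v]\rangle$, and $\to_{\mathtt e}$ that of $t[x\leftarrow L\langle v\rangle]\mapsto L\langle t\{x\leftarrow v\}\rangle$ (bound variables of $L$ not free in the other subterm); $\to_{\mathsf{vsub}_k}=\to_{\mathtt m}\cup\to_{\mathtt e}$. Value sequent calculus: commands $c::=\langle v\mid e\rangle$; values $v::=x\mid\lambda x.c$; environments $e::=\epsilon\mid\tilde\mu x.c\mid v\cdot e$, where $\lambda x.c$ and $\tilde\mu x.c$ bind $x$ in $c$. Append: $\langle v\mid e'\rangle@e=\langle v\mid e'@e\rangle$;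 $\epsilon@e=e$; $(v\cdot e')@e=v\cdot(e'@e)$; $(\tilde\mu x.c)@e=\tilde\mu y.(c\{x\leftarrow y\}@e)$ with $y$ fresh. Contexts: $C::=\langle\cdot\rangle\mid D\langle\tilde\mu x.C\rangle$, $D::=\langle v\mid\langle\cdot\rangle\rangle\mid D\langle v\cdot\langle\cdot\rangle\rangle$. Root rules $\langle\lambda x.c\mid v\cdot e\rangle\mapsto_{\bar\lambda}\langle v\mid(\tilde\mu x.c)@e\rangle$ and $\langle v\mid\tilde\mu x.c\rangle\mapsto_{\tilde\mu}c\{x\leftarrow v\}$; $\to_{\bar\lambda},\to_{\tilde\mu}$ are their closures under contexts $C$ ($C\langle c\rangle\to C\langle c'\rangle$ if $c\mapsto c'$); $\to_{\mathsf{vseq}}=\to_{\bar\lambda}\cup\to_{\tilde\mu}$. Translation: on values $x^{\bullet}=x$, $(\lambda x.t)^{\bullet}=\lambda x.t^{\circ}$; on terms $v^{\circ}=\langle v^{\bullet}\mid\epsilon\rangle$, $(tv)^{\circ}=t^{\circ}@(v^{\bullet}\cdot\epsilon)$, $(t[x\leftarrow u])^{\circ}=u^{\circ}@(\tilde\mu x.t^{\circ})$. $|d|$ is the length of $d$ and $|d|_{\mathsf r}$ its number of $\mathsf r$-steps. -}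

module Defs where

open import Data.Nat using (ℕ; zero; suc; _+_)
open import Data.Fin using (Fin; zero; suc)
open import Data.Sum using (_⊎_; inj₁; inj₂)
open import Data.Product using (∃)
open import Relation.Nullary using (¬_)
open import Relation.Binary.Construct.Closure.ReflexiveTransitive using (Star; ε; _◅_)

-- Scoped de Bruijn syntax: a term of type `X n` has free variables in `Fin n`.
-- Index 0 is the most recently bound variable. This realises "up to α".

mutual
  data Val : ℕ → Set where
    var : ∀ {n} → Fin n → Val n
    lam : ∀ {n} → Tm (suc n) → Val n

  data Tm : ℕ → Set where
    val : ∀ {n} → Val n → Tm n
    app : ∀ {n} → Tm n → Val n → Tm n
    es  : ∀ {n} → Tm (suc n) → Tm n → Tm n     -- t[x←u], x bound in t

Ren : ℕ → ℕ → Set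
Ren n m = Fin n → Fin m

liftR : ∀ {n m} → Ren n m → Ren (suc n) (suc m)
liftR ρ zero    = zero
liftR ρ (suc i) = suc (ρ i)

mutual
  renV : ∀ {n m} → Ren n m → Val n → Val m
  renV ρ (var i) = var (ρ i)
  renV ρ (lam t) = lam (renT (liftR ρ) t)

  renT : ∀ {n m} → Ren n m → Tm n → Tm m
  renT ρ (val v)  = val (renV ρ v)
  renT ρ (app t v) = app (renT ρ t) (renV ρ v)
  renT ρ (es t u) = es (renT (liftR ρ) t) (renT ρ u)

SubV : ℕ → ℕ → Set
SubV n m = Fin n → Val m

liftS : ∀ {n m} → SubV n m → SubV (suc n) (suc m)
liftS σ zero    = var zero
liftS σ (suc i) = renV suc (σ i)

mutual
  subV : ∀ {n m} → SubV n m → Val n → Val m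
  subV σ (var i) = σ i
  subV σ (lam t) = lam (subT (liftS σ) t)

  subT : ∀ {n m} → SubV n m → Tm n → Tm m
  subT σ (val v)   = val (subV σ v)
  subT σ (app t v) = app (subT σ t) (subV σ v)
  subT σ (es t u)  = es (subT (liftS σ) t) (subT σ u)

single : ∀ {n} → Val n → SubV (suc n) n
single v zero    = v
single v (suc i) = var i

_[0≔_] : ∀ {n} → Tm (suc n) → Val n → Tm n
t [0≔ v ] = subT (single v) t

-- Substitution contexts L ::= ⟨·⟩ | L[x←u]; `SCtx n m`: outer scope n, hole scope m.
data SCtx : ℕ → ℕ → Set where
  hole : ∀ {n} → SCtx n n
  _[←_] : ∀ {n m} → SCtx (suc n) m → Tm n → SCtx n m

plugL : ∀ {n m} → SCtx n m → Tm m → Tm n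
plugL hole t       = t
plugL (L [← u ]) t = es (plugL L t) u

-- weakening of the outer scope into the hole scope (the binders of L are fresh)
wkL : ∀ {n m} → SCtx n m → Ren n m
wkL hole       i = i
wkL (L [← u ]) i = wkL L (suc i)

data RootM : ∀ {n} → Tm n → Tm n → Set where
  -- L⟨λx.t⟩ v ↦ L⟨t[x←v]⟩
  rm : ∀ {n m} (L : SCtx n m) (t : Tm (suc m)) (v : Val n) →
       RootM (app (plugL L (val (lam t))) v) (plugL L (es t (val (renV (wkL L) v))))

data RootE : ∀ {n} → Tm n → Tm n → Set where
  -- t[x←L⟨v⟩] ↦ L⟨t{x←v}⟩
  re : ∀ {n m} (L : SCtx n m) (t : Tm (suc n)) (v : Val m) →
       RootE (es t (plugL L (val v))) (plugL L (renT (liftR (wkL L)) t [0≔ v ]))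

data EClos (R : ∀ {n} → Tm n → Tm n → Set) : ∀ {n} → Tm n → Tm n → Set where
  root : ∀ {n} {t t' : Tm n} → R t t' → EClos R t t'
  appL : ∀ {n} {t t' : Tm n} (v : Val n) → EClos R t t' → EClos R (app t v) (app t' v)
  esL  : ∀ {n} {t t' : Tm (suc n)} (u : Tm n) → EClos R t t' → EClos R (es t u) (es t' u)
  esR  : ∀ {n} (t : Tm (suc n)) {u u' : Tm n} → EClos R u u' → EClos R (es t u) (es t u')

_→m_ : ∀ {n} → Tm n → Tm n → Set
_→m_ = EClos RootM

_→e_ : ∀ {n} → Tm n → Tm n → Set
_→e_ = EClos RootE

_→vsub_ : ∀ {n} → Tm n → Tm n → Set
t →vsub u = (t →m u) ⊎ (t →e u)

VsubNormal : ∀ {n} → Tm n → Set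
VsubNormal t = ¬ ∃ (λ t' → t →vsub t')

infixr 20 _·_

mutual
  data SVal : ℕ → Set where
    svar : ∀ {n} → Fin n → SVal n
    slam : ∀ {n} → Cmd (suc n) → SVal n

  data Env : ℕ → Set where
    εₑ  : ∀ {n} → Env n
    μ̃   : ∀ {n} → Cmd (suc n) → Env n
    _·_ : ∀ {n} → SVal n → Env n → Env n

  data Cmd : ℕ → Set where
    ⟨_∣_⟩ : ∀ {n} → SVal n → Env n → Cmd n

mutual
  renSV : ∀ {n m} → Ren n m → SVal n → SVal m
  renSV ρ (svar i) = svar (ρ i)
  renSV ρ (slam c) = slam (renC (liftR ρ) c)

  renEnv : ∀ {n m} → Ren n m → Env n → Env m
  renEnv ρ εₑ      = εₑ
  renEnv ρ (μ̃ c)   = μ̃ (renC (liftR ρ) c)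
  renEnv ρ (v · e) = renSV ρ v · renEnv ρ e

  renC : ∀ {n m} → Ren n m → Cmd n → Cmd m
  renC ρ ⟨ v ∣ e ⟩ = ⟨ renSV ρ v ∣ renEnv ρ e ⟩

SubS : ℕ → ℕ → Set
SubS n m = Fin n → SVal m

liftSS : ∀ {n m} → SubS n m → SubS (suc n) (suc m)
liftSS σ zero    = svar zero
liftSS σ (suc i) = renSV suc (σ i)

mutual
  subSV : ∀ {n m} → SubS n m → SVal n → SVal m
  subSV σ (svar i) = σ i
  subSV σ (slam c) = slam (subC (liftSS σ) c)

  subEnv : ∀ {n m} → SubS n m → Env n → Env m
  subEnv σ εₑ      = εₑ
  subEnv σ (μ̃ c)   = μ̃ (subC (liftSS σ) c)
  subEnv σ (v · e) = subSV σ v · subEnv σ e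

  subC : ∀ {n m} → SubS n m → Cmd n → Cmd m
  subC σ ⟨ v ∣ e ⟩ = ⟨ subSV σ v ∣ subEnv σ e ⟩

singleS : ∀ {n} → SVal n → SubS (suc n) n
singleS v zero    = v
singleS v (suc i) = svar i

_[0≔ₛ_] : ∀ {n} → Cmd (suc n) → SVal n → Cmd n
c [0≔ₛ v ] = subC (singleS v) c

-- Append @  (μ̃x.c)@e = μ̃y.(c{x←y}@e), written ++c / ++e: in de Bruijn form, e is weakened under the binder.
infixr 15 _++c_ _++e_

mutual
  _++c_ : ∀ {n} → Cmd n → Env n → Cmd n
  ⟨ v ∣ e' ⟩ ++c e = ⟨ v ∣ e' ++e e ⟩

  _++e_ : ∀ {n} → Env n → Env n → Env n
  εₑ       ++e e = e
  (v · e') ++e e = v · (e' ++e e)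
  μ̃ c      ++e e = μ̃ (c ++c renEnv suc e)

data DCtx : ℕ → Set where
  dhole : ∀ {n} → SVal n → DCtx n
  dcons : ∀ {n} → DCtx n → SVal n → DCtx n

plugD : ∀ {n} → DCtx n → Env n → Cmd n
plugD (dhole v)   e = ⟨ v ∣ e ⟩
plugD (dcons D v) e = plugD D (v · e)

data Rootλ̄ : ∀ {n} → Cmd n → Cmd n → Set where
  rl : ∀ {n} (c : Cmd (suc n)) (v : SVal n) (e : Env n) →
       Rootλ̄ ⟨ slam c ∣ v · e ⟩ ⟨ v ∣ μ̃ c ++e e ⟩

data Rootμ̃ : ∀ {n} → Cmd n → Cmd n → Set where
  rmu : ∀ {n} (v : SVal n) (c : Cmd (suc n)) →
        Rootμ̃ ⟨ v ∣ μ̃ c ⟩ (c [0≔ₛ v ])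

data CClos (R : ∀ {n} → Cmd n → Cmd n → Set) : ∀ {n} → Cmd n → Cmd n → Set where
  root : ∀ {n} {c c' : Cmd n} → R c c' → CClos R c c'
  under : ∀ {n} (D : DCtx n) {c c' : Cmd (suc n)} →
          CClos R c c' → CClos R (plugD D (μ̃ c)) (plugD D (μ̃ c'))

_→λ̄_ : ∀ {n} → Cmd n → Cmd n → Set
_→λ̄_ = CClos Rootλ̄

_→μ̃_ : ∀ {n} → Cmd n → Cmd n → Set
_→μ̃_ = CClos Rootμ̃

_→vseq_ : ∀ {n} → Cmd n → Cmd n → Set
c →vseq c' = (c →λ̄ c') ⊎ (c →μ̃ c')

VseqNormal : ∀ {n} → Cmd n → Set
VseqNormal c = ¬ ∃ (λ c' → c →vseq c')

infix 30 _• _°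

mutual
  _• : ∀ {n} → Val n → SVal n
  var x •  = svar x
  lam t •  = slam (t °)

  _° : ∀ {n} → Tm n → Cmd n
  val v °   = ⟨ v • ∣ εₑ ⟩
  app t v ° = (t °) ++c (v • · εₑ)
  es t u °  = (u °) ++c μ̃ (t °)

len : ∀ {A : Set} {R : A → A → Set} {x y : A} → Star R x y → ℕ
len ε        = 0
len (_ ◅ d)  = suc (len d)

countˡ : ∀ {A : Set} {R S : A → A → Set} {x y : A} →
         Star (λ a b → R a b ⊎ S a b) x y → ℕ
countˡ ε             = 0
countˡ (inj₁ _ ◅ d)  = suc (countˡ d)
countˡ (inj₂ _ ◅ d)  = countˡ d

countʳ : ∀ {A : Set} {R S : A → A → Set} {x y : A} →
         Star (λ a b → R a b ⊎ S a b) x y → ℕ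
countʳ ε             = 0
countʳ (inj₁ _ ◅ d)  = countʳ d
countʳ (inj₂ _ ◅ d)  = suc (countʳ d)

count-m : ∀ {n} {t u : Tm n} → Star _→vsub_ t u → ℕ
count-m = countˡ {R = _→m_} {S = _→e_}

count-e : ∀ {n} {t u : Tm n} → Star _→vsub_ t u → ℕ
count-e = countʳ {R = _→m_} {S = _→e_}

count-λ̄ : ∀ {n} {c c' : Cmd n} → Star _→vseq_ c c' → ℕ
count-λ̄ = countˡ {R = _→λ̄_} {S = _→μ̃_}

count-μ̃ : ∀ {n} {c c' : Cmd n} → Star _→vseq_ c c' → ℕ
count-μ̃ = countʳ {R = _→λ̄_} {S = _→μ̃_}

module Submission where

-- The translation (·)° from vsub_k into the value sequent calculus is a
-- step-by-step simulation: every m-step becomes exactly one λ̄-step and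
-- every e-step exactly one μ̃-step, so a derivation is mapped stepwise and
-- both counts (hence the length) are preserved; and normal forms go to
-- normal forms.

open import Defs
open import Data.Nat using (ℕ; suc; _+_)
open import Data.Nat.Properties using (+-suc)
open import Data.Fin using (Fin; zero; suc)
open import Data.Product using (Σ; _×_; _,_; ∃)
open import Data.Sum using (_⊎_; inj₁; inj₂)
import Data.Sum as Sum
open import Data.Empty using (⊥)
open import Relation.Binary.PropositionalEquality
open import Relation.Binary.Construct.Closure.ReflexiveTransitive using (Star; ε; _◅_; gmap)

open ≡-Reasoning

liftR-id : ∀ {n} {ρ : Ren n n} → (∀ i → ρ i ≡ i) → ∀ i → liftR ρ i ≡ i
liftR-id h zero    = refl
liftR-id h (suc i) = cong suc (h i)

mutual
  renSV-id : ∀ {n} {ρ : Ren n n} → (∀ i → ρ i ≡ i) → ∀ v → renSV ρ v ≡ v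
  renSV-id h (svar i) = cong svar (h i)
  renSV-id h (slam c) = cong slam (renC-id (liftR-id h) c)

  renEnv-id : ∀ {n} {ρ : Ren n n} → (∀ i → ρ i ≡ i) → ∀ e → renEnv ρ e ≡ e
  renEnv-id h εₑ      = refl
  renEnv-id h (μ̃ c)   = cong μ̃ (renC-id (liftR-id h) c)
  renEnv-id h (v · e) = cong₂ _·_ (renSV-id h v) (renEnv-id h e)

  renC-id : ∀ {n} {ρ : Ren n n} → (∀ i → ρ i ≡ i) → ∀ c → renC ρ c ≡ c
  renC-id h ⟨ v ∣ e ⟩ = cong₂ ⟨_∣_⟩ (renSV-id h v) (renEnv-id h e)

liftR-fuse : ∀ {n m k} {ρ : Ren m k} {ρ' : Ren n m} {ρ'' : Ren n k} →
  (∀ i → ρ (ρ' i) ≡ ρ'' i) → ∀ i → liftR ρ (liftR ρ' i) ≡ liftR ρ'' i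
liftR-fuse h zero    = refl
liftR-fuse h (suc i) = cong suc (h i)

mutual
  renSV-ren : ∀ {n m k} {ρ : Ren m k} {ρ' : Ren n m} {ρ'' : Ren n k} →
    (∀ i → ρ (ρ' i) ≡ ρ'' i) → ∀ v → renSV ρ (renSV ρ' v) ≡ renSV ρ'' v
  renSV-ren h (svar i) = cong svar (h i)
  renSV-ren h (slam c) = cong slam (renC-ren (liftR-fuse h) c)

  renEnv-ren : ∀ {n m k} {ρ : Ren m k} {ρ' : Ren n m} {ρ'' : Ren n k} →
    (∀ i → ρ (ρ' i) ≡ ρ'' i) → ∀ e → renEnv ρ (renEnv ρ' e) ≡ renEnv ρ'' e
  renEnv-ren h εₑ      = refl
  renEnv-ren h (μ̃ c)   = cong μ̃ (renC-ren (liftR-fuse h) c)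
  renEnv-ren h (v · e) = cong₂ _·_ (renSV-ren h v) (renEnv-ren h e)

  renC-ren : ∀ {n m k} {ρ : Ren m k} {ρ' : Ren n m} {ρ'' : Ren n k} →
    (∀ i → ρ (ρ' i) ≡ ρ'' i) → ∀ c → renC ρ (renC ρ' c) ≡ renC ρ'' c
  renC-ren h ⟨ v ∣ e ⟩ = cong₂ ⟨_∣_⟩ (renSV-ren h v) (renEnv-ren h e)

liftSS-ext : ∀ {n m} {σ σ' : SubS n m} → (∀ i → σ i ≡ σ' i) → ∀ i → liftSS σ i ≡ liftSS σ' i
liftSS-ext h zero    = refl
liftSS-ext h (suc i) = cong (renSV suc) (h i)

mutual
  subSV-ext : ∀ {n m} {σ σ' : SubS n m} → (∀ i → σ i ≡ σ' i) → ∀ v → subSV σ v ≡ subSV σ' v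
  subSV-ext h (svar i) = h i
  subSV-ext h (slam c) = cong slam (subC-ext (liftSS-ext h) c)

  subEnv-ext : ∀ {n m} {σ σ' : SubS n m} → (∀ i → σ i ≡ σ' i) → ∀ e → subEnv σ e ≡ subEnv σ' e
  subEnv-ext h εₑ      = refl
  subEnv-ext h (μ̃ c)   = cong μ̃ (subC-ext (liftSS-ext h) c)
  subEnv-ext h (v · e) = cong₂ _·_ (subSV-ext h v) (subEnv-ext h e)

  subC-ext : ∀ {n m} {σ σ' : SubS n m} → (∀ i → σ i ≡ σ' i) → ∀ c → subC σ c ≡ subC σ' c
  subC-ext h ⟨ v ∣ e ⟩ = cong₂ ⟨_∣_⟩ (subSV-ext h v) (subEnv-ext h e)

liftSS-ren : ∀ {n m k} {σ : SubS m k} {ρ : Ren n m} {σ' : SubS n k} →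
  (∀ i → σ (ρ i) ≡ σ' i) → ∀ i → liftSS σ (liftR ρ i) ≡ liftSS σ' i
liftSS-ren h zero    = refl
liftSS-ren h (suc i) = cong (renSV suc) (h i)

mutual
  subSV-ren : ∀ {n m k} {σ : SubS m k} {ρ : Ren n m} {σ' : SubS n k} →
    (∀ i → σ (ρ i) ≡ σ' i) → ∀ v → subSV σ (renSV ρ v) ≡ subSV σ' v
  subSV-ren h (svar i) = h i
  subSV-ren h (slam c) = cong slam (subC-ren (liftSS-ren h) c)

  subEnv-ren : ∀ {n m k} {σ : SubS m k} {ρ : Ren n m} {σ' : SubS n k} →
    (∀ i → σ (ρ i) ≡ σ' i) → ∀ e → subEnv σ (renEnv ρ e) ≡ subEnv σ' e
  subEnv-ren h εₑ      = refl
  subEnv-ren h (μ̃ c)   = cong μ̃ (subC-ren (liftSS-ren h) c)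
  subEnv-ren h (v · e) = cong₂ _·_ (subSV-ren h v) (subEnv-ren h e)

  subC-ren : ∀ {n m k} {σ : SubS m k} {ρ : Ren n m} {σ' : SubS n k} →
    (∀ i → σ (ρ i) ≡ σ' i) → ∀ c → subC σ (renC ρ c) ≡ subC σ' c
  subC-ren h ⟨ v ∣ e ⟩ = cong₂ ⟨_∣_⟩ (subSV-ren h v) (subEnv-ren h e)

renLiftSS : ∀ {n m k} {ρ : Ren m k} {σ : SubS n m} {σ' : SubS n k} →
  (∀ i → renSV ρ (σ i) ≡ σ' i) → ∀ i → renSV (liftR ρ) (liftSS σ i) ≡ liftSS σ' i
renLiftSS h zero = refl
renLiftSS {ρ = ρ} {σ} {σ'} h (suc i) = begin
  renSV (liftR ρ) (renSV suc (σ i))  ≡⟨ renSV-ren (λ _ → refl) (σ i) ⟩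
  renSV (λ j → suc (ρ j)) (σ i)      ≡⟨ sym (renSV-ren (λ _ → refl) (σ i)) ⟩
  renSV suc (renSV ρ (σ i))          ≡⟨ cong (renSV suc) (h i) ⟩
  renSV suc (σ' i)                   ∎

mutual
  renSV-sub : ∀ {n m k} {ρ : Ren m k} {σ : SubS n m} {σ' : SubS n k} →
    (∀ i → renSV ρ (σ i) ≡ σ' i) → ∀ v → renSV ρ (subSV σ v) ≡ subSV σ' v
  renSV-sub h (svar i) = h i
  renSV-sub h (slam c) = cong slam (renC-sub (renLiftSS h) c)

  renEnv-sub : ∀ {n m k} {ρ : Ren m k} {σ : SubS n m} {σ' : SubS n k} →
    (∀ i → renSV ρ (σ i) ≡ σ' i) → ∀ e → renEnv ρ (subEnv σ e) ≡ subEnv σ' e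
  renEnv-sub h εₑ      = refl
  renEnv-sub h (μ̃ c)   = cong μ̃ (renC-sub (renLiftSS h) c)
  renEnv-sub h (v · e) = cong₂ _·_ (renSV-sub h v) (renEnv-sub h e)

  renC-sub : ∀ {n m k} {ρ : Ren m k} {σ : SubS n m} {σ' : SubS n k} →
    (∀ i → renSV ρ (σ i) ≡ σ' i) → ∀ c → renC ρ (subC σ c) ≡ subC σ' c
  renC-sub h ⟨ v ∣ e ⟩ = cong₂ ⟨_∣_⟩ (renSV-sub h v) (renEnv-sub h e)

liftSS-id : ∀ {n} {σ : SubS n n} → (∀ i → σ i ≡ svar i) → ∀ i → liftSS σ i ≡ svar i
liftSS-id h zero    = refl
liftSS-id h (suc i) = cong (renSV suc) (h i)

mutual
  subSV-id : ∀ {n} {σ : SubS n n} → (∀ i → σ i ≡ svar i) → ∀ v → subSV σ v ≡ v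
  subSV-id h (svar i) = h i
  subSV-id h (slam c) = cong slam (subC-id (liftSS-id h) c)

  subEnv-id : ∀ {n} {σ : SubS n n} → (∀ i → σ i ≡ svar i) → ∀ e → subEnv σ e ≡ e
  subEnv-id h εₑ      = refl
  subEnv-id h (μ̃ c)   = cong μ̃ (subC-id (liftSS-id h) c)
  subEnv-id h (v · e) = cong₂ _·_ (subSV-id h v) (subEnv-id h e)

  subC-id : ∀ {n} {σ : SubS n n} → (∀ i → σ i ≡ svar i) → ∀ c → subC σ c ≡ c
  subC-id h ⟨ v ∣ e ⟩ = cong₂ ⟨_∣_⟩ (subSV-id h v) (subEnv-id h e)

ren-weaken : ∀ {n m} (ρ : Ren n m) (e : Env n) →
  renEnv (liftR ρ) (renEnv suc e) ≡ renEnv suc (renEnv ρ e)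
ren-weaken ρ e = trans (renEnv-ren (λ _ → refl) e) (sym (renEnv-ren (λ _ → refl) e))

sub-weaken : ∀ {n m} (σ : SubS n m) (e : Env n) →
  subEnv (liftSS σ) (renEnv suc e) ≡ renEnv suc (subEnv σ e)
sub-weaken σ e = trans (subEnv-ren (λ _ → refl) e) (sym (renEnv-sub (λ _ → refl) e))

sub-single-weaken : ∀ {n} (v : SVal n) (e : Env n) → subEnv (singleS v) (renEnv suc e) ≡ e
sub-single-weaken v e = trans (subEnv-ren (λ _ → refl) e) (subEnv-id (λ _ → refl) e)

mutual
  ren-++e : ∀ {n m} (ρ : Ren n m) (e₁ e₂ : Env n) →
    renEnv ρ (e₁ ++e e₂) ≡ renEnv ρ e₁ ++e renEnv ρ e₂
  ren-++e ρ εₑ       e₂ = refl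
  ren-++e ρ (v · e₁) e₂ = cong (renSV ρ v ·_) (ren-++e ρ e₁ e₂)
  ren-++e ρ (μ̃ c)    e₂ = cong μ̃ (trans (ren-++c (liftR ρ) c (renEnv suc e₂))
                                         (cong (renC (liftR ρ) c ++c_) (ren-weaken ρ e₂)))

  ren-++c : ∀ {n m} (ρ : Ren n m) (c : Cmd n) (e : Env n) →
    renC ρ (c ++c e) ≡ renC ρ c ++c renEnv ρ e
  ren-++c ρ ⟨ v ∣ e' ⟩ e = cong ⟨ renSV ρ v ∣_⟩ (ren-++e ρ e' e)

mutual
  sub-++e : ∀ {n m} (σ : SubS n m) (e₁ e₂ : Env n) →
    subEnv σ (e₁ ++e e₂) ≡ subEnv σ e₁ ++e subEnv σ e₂
  sub-++e σ εₑ       e₂ = refl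
  sub-++e σ (v · e₁) e₂ = cong (subSV σ v ·_) (sub-++e σ e₁ e₂)
  sub-++e σ (μ̃ c)    e₂ = cong μ̃ (trans (sub-++c (liftSS σ) c (renEnv suc e₂))
                                         (cong (subC (liftSS σ) c ++c_) (sub-weaken σ e₂)))

  sub-++c : ∀ {n m} (σ : SubS n m) (c : Cmd n) (e : Env n) →
    subC σ (c ++c e) ≡ subC σ c ++c subEnv σ e
  sub-++c σ ⟨ v ∣ e' ⟩ e = cong ⟨ subSV σ v ∣_⟩ (sub-++e σ e' e)

mutual
  assoc-++e : ∀ {n} (e₀ e₁ e₂ : Env n) → (e₀ ++e e₁) ++e e₂ ≡ e₀ ++e (e₁ ++e e₂)
  assoc-++e εₑ       e₁ e₂ = refl
  assoc-++e (v · e₀) e₁ e₂ = cong (v ·_) (assoc-++e e₀ e₁ e₂)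
  assoc-++e (μ̃ c)    e₁ e₂ = cong μ̃ (trans (assoc-++c c (renEnv suc e₁) (renEnv suc e₂))
                                            (cong (c ++c_) (sym (ren-++e suc e₁ e₂))))

  assoc-++c : ∀ {n} (c : Cmd n) (e₁ e₂ : Env n) → (c ++c e₁) ++c e₂ ≡ c ++c (e₁ ++e e₂)
  assoc-++c ⟨ v ∣ e ⟩ e₁ e₂ = cong ⟨ v ∣_⟩ (assoc-++e e e₁ e₂)

mutual
  unit-++e : ∀ {n} (e : Env n) → e ++e εₑ ≡ e
  unit-++e εₑ      = refl
  unit-++e (v · e) = cong (v ·_) (unit-++e e)
  unit-++e (μ̃ c)   = cong μ̃ (unit-++c c)

  unit-++c : ∀ {n} (c : Cmd n) → c ++c εₑ ≡ c
  unit-++c ⟨ v ∣ e ⟩ = cong ⟨ v ∣_⟩ (unit-++e e)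

mutual
  tr-renV : ∀ {n m} (ρ : Ren n m) (v : Val n) → (renV ρ v) • ≡ renSV ρ (v •)
  tr-renV ρ (var x) = refl
  tr-renV ρ (lam t) = cong slam (tr-renT (liftR ρ) t)

  tr-renT : ∀ {n m} (ρ : Ren n m) (t : Tm n) → (renT ρ t) ° ≡ renC ρ (t °)
  tr-renT ρ (val v)   = cong (λ w → ⟨ w ∣ εₑ ⟩) (tr-renV ρ v)
  tr-renT ρ (app t v) = trans (cong₂ (λ a b → a ++c (b · εₑ)) (tr-renT ρ t) (tr-renV ρ v))
                              (sym (ren-++c ρ (t °) (v • · εₑ)))
  tr-renT ρ (es t u)  = trans (cong₂ (λ a b → a ++c μ̃ b) (tr-renT ρ u) (tr-renT (liftR ρ) t))
                              (sym (ren-++c ρ (u °) (μ̃ (t °))))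

trS : ∀ {n m} → SubV n m → SubS n m
trS σ i = (σ i) •

trS-lift : ∀ {n m} (σ : SubV n m) → ∀ i → trS (liftS σ) i ≡ liftSS (trS σ) i
trS-lift σ zero    = refl
trS-lift σ (suc i) = tr-renV suc (σ i)

mutual
  tr-subV : ∀ {n m} (σ : SubV n m) (v : Val n) → (subV σ v) • ≡ subSV (trS σ) (v •)
  tr-subV σ (var x) = refl
  tr-subV σ (lam t) = cong slam (tr-subBody σ t)

  tr-subT : ∀ {n m} (σ : SubV n m) (t : Tm n) → (subT σ t) ° ≡ subC (trS σ) (t °)
  tr-subT σ (val v)   = cong (λ w → ⟨ w ∣ εₑ ⟩) (tr-subV σ v)
  tr-subT σ (app t v) = trans (cong₂ (λ a b → a ++c (b · εₑ)) (tr-subT σ t) (tr-subV σ v))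
                              (sym (sub-++c (trS σ) (t °) (v • · εₑ)))
  tr-subT σ (es t u)  = trans (cong₂ (λ a b → a ++c μ̃ b) (tr-subT σ u) (tr-subBody σ t))
                              (sym (sub-++c (trS σ) (u °) (μ̃ (t °))))

  tr-subBody : ∀ {n m} (σ : SubV n m) (t : Tm (suc n)) →
    (subT (liftS σ) t) ° ≡ subC (liftSS (trS σ)) (t °)
  tr-subBody σ t = trans (tr-subT (liftS σ) t) (subC-ext (trS-lift σ) (t °))

tr-single : ∀ {n} (t : Tm (suc n)) (v : Val n) → (t [0≔ v ]) ° ≡ (t °) [0≔ₛ v • ]
tr-single t v = trans (tr-subT (single v) t) (subC-ext single-tr (t °))
  where
  single-tr : ∀ i → trS (single v) i ≡ singleS (v •) i
  single-tr zero    = refl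
  single-tr (suc i) = refl

renD : ∀ {n m} → Ren n m → DCtx n → DCtx m
renD ρ (dhole v)   = dhole (renSV ρ v)
renD ρ (dcons D v) = dcons (renD ρ D) (renSV ρ v)

ren-plugD : ∀ {n m} (ρ : Ren n m) (D : DCtx n) (e : Env n) →
  renC ρ (plugD D e) ≡ plugD (renD ρ D) (renEnv ρ e)
ren-plugD ρ (dhole v)   e = refl
ren-plugD ρ (dcons D v) e = ren-plugD ρ D (v · e)

plugD-++ : ∀ {n} (D : DCtx n) (e e' : Env n) → plugD D e ++c e' ≡ plugD D (e ++e e')
plugD-++ (dhole v)   e e' = refl
plugD-++ (dcons D v) e e' = plugD-++ D (v · e) e'

plugLC : ∀ {n m} → SCtx n m → Cmd m → Cmd n
plugLC hole       c = c
plugLC (L [← u ]) c = (u °) ++c μ̃ (plugLC L c)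

plugL° : ∀ {n m} (L : SCtx n m) (s : Tm m) → (plugL L s) ° ≡ plugLC L (s °)
plugL° hole       s = refl
plugL° (L [← u ]) s = cong (λ x → (u °) ++c μ̃ x) (plugL° L s)

plugLC-++ : ∀ {n m} (L : SCtx n m) (c : Cmd m) (e : Env n) →
  plugLC L c ++c e ≡ plugLC L (c ++c renEnv (wkL L) e)
plugLC-++ hole c e = cong (c ++c_) (sym (renEnv-id (λ _ → refl) e))
plugLC-++ (L [← u ]) c e = begin
  ((u °) ++c μ̃ (plugLC L c)) ++c e                        ≡⟨ assoc-++c (u °) (μ̃ (plugLC L c)) e ⟩
  (u °) ++c μ̃ (plugLC L c ++c renEnv suc e)               ≡⟨ cong (λ x → (u °) ++c μ̃ x) (plugLC-++ L c (renEnv suc e)) ⟩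
  (u °) ++c μ̃ (plugLC L (c ++c renEnv (wkL L) (renEnv suc e)))
    ≡⟨ cong (λ y → (u °) ++c μ̃ (plugLC L (c ++c y))) (renEnv-ren (λ _ → refl) e) ⟩
  (u °) ++c μ̃ (plugLC L (c ++c renEnv (wkL (L [← u ])) e)) ∎

module Closure (R : ∀ {n} → Cmd n → Cmd n → Set)
  (R-ren : ∀ {n m} (ρ : Ren n m) {c c' : Cmd n} → R c c' → R (renC ρ c) (renC ρ c'))
  (R-++ : ∀ {n} (e : Env n) {c c' : Cmd n} → R c c' → R (c ++c e) (c' ++c e)) where

  ren-step : ∀ {n m} (ρ : Ren n m) {c c' : Cmd n} → CClos R c c' → CClos R (renC ρ c) (renC ρ c')
  ren-step ρ (root r) = root (R-ren ρ r)
  ren-step ρ (under D {c} {c'} s) =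
    subst₂ (CClos R) (sym (ren-plugD ρ D (μ̃ c))) (sym (ren-plugD ρ D (μ̃ c')))
      (under (renD ρ D) (ren-step (liftR ρ) s))

  ++-step : ∀ {n} (e : Env n) {c c' : Cmd n} → CClos R c c' → CClos R (c ++c e) (c' ++c e)
  ++-step e (root r) = root (R-++ e r)
  ++-step e (under D {c} {c'} s) =
    subst₂ (CClos R) (sym (plugD-++ D (μ̃ c) e)) (sym (plugD-++ D (μ̃ c') e))
      (under D (++-step (renEnv suc e) s))

  -- A step under μ̃ at the end of an environment e₀ is a C-context step;
  -- a μ̃ inside e₀ itself shifts the step one binder deeper.
  under-env : ∀ {n} (D : DCtx n) (e₀ : Env n) {c c' : Cmd (suc n)} → CClos R c c' →
    CClos R (plugD D (e₀ ++e μ̃ c)) (plugD D (e₀ ++e μ̃ c'))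
  under-env D εₑ              s = under D s
  under-env D (v · e₀)        s = under-env (dcons D v) e₀ s
  under-env D (μ̃ ⟨ w ∣ e₁ ⟩) s = under D (under-env (dhole w) e₁ (ren-step (liftR suc) s))

  under-cmd : ∀ {n} (c₀ : Cmd n) {c c' : Cmd (suc n)} → CClos R c c' →
    CClos R (c₀ ++c μ̃ c) (c₀ ++c μ̃ c')
  under-cmd ⟨ w ∣ e₀ ⟩ s = under-env (dhole w) e₀ s

  under-subctx : ∀ {n m} (L : SCtx n m) {c c' : Cmd m} → CClos R c c' →
    CClos R (plugLC L c) (plugLC L c')
  under-subctx hole       s = s
  under-subctx (L [← u ]) s = under-cmd (u °) (under-subctx L s)

  under-eval : ∀ {n} (R' : ∀ {k} → Tm k → Tm k → Set) →
    (∀ {k} {t t' : Tm k} → R' t t' → CClos R (t °) (t' °)) →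
    ∀ {t t' : Tm n} → EClos R' t t' → CClos R (t °) (t' °)
  under-eval R' sim-root (root r)  = sim-root r
  under-eval R' sim-root (appL v s) = ++-step (v • · εₑ) (under-eval R' sim-root s)
  under-eval R' sim-root (esL u s)  = under-cmd (u °) (under-eval R' sim-root s)
  under-eval R' sim-root (esR t s)  = ++-step (μ̃ (t °)) (under-eval R' sim-root s)

λ̄-ren : ∀ {n m} (ρ : Ren n m) {c c' : Cmd n} → Rootλ̄ c c' → Rootλ̄ (renC ρ c) (renC ρ c')
λ̄-ren ρ (rl c v e) =
  subst (λ x → Rootλ̄ ⟨ slam (renC (liftR ρ) c) ∣ renSV ρ v · renEnv ρ e ⟩ ⟨ renSV ρ v ∣ x ⟩) (sym (ren-++e ρ (μ̃ c) e)) (rl _ _ _)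

λ̄-++ : ∀ {n} (e' : Env n) {c c' : Cmd n} → Rootλ̄ c c' → Rootλ̄ (c ++c e') (c' ++c e')
λ̄-++ e' (rl c v e) =
  subst (λ x → Rootλ̄ ⟨ slam c ∣ v · (e ++e e') ⟩ ⟨ v ∣ x ⟩) (sym (assoc-++e (μ̃ c) e e')) (rl _ _ _)

μ̃-ren : ∀ {n m} (ρ : Ren n m) {c c' : Cmd n} → Rootμ̃ c c' → Rootμ̃ (renC ρ c) (renC ρ c')
μ̃-ren ρ (rmu v c) =
  subst (Rootμ̃ _) (trans (subC-ren single-ren c) (sym (renC-sub (λ _ → refl) c)))
    (rmu (renSV ρ v) (renC (liftR ρ) c))
  where
  single-ren : ∀ i → singleS (renSV ρ v) (liftR ρ i) ≡ renSV ρ (singleS v i)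
  single-ren zero    = refl
  single-ren (suc i) = refl

μ̃-++ : ∀ {n} (e : Env n) {c c' : Cmd n} → Rootμ̃ c c' → Rootμ̃ (c ++c e) (c' ++c e)
μ̃-++ e (rmu v c) =
  subst (Rootμ̃ _)
    (trans (sub-++c (singleS v) c (renEnv suc e))
           (cong (subC (singleS v) c ++c_) (sub-single-weaken v e)))
    (rmu v (c ++c renEnv suc e))

module Cλ̄ = Closure Rootλ̄ λ̄-ren λ̄-++
module Cμ̃ = Closure Rootμ̃ μ̃-ren μ̃-++

-- One-step simulation.  At the root, (L⟨λx.t⟩ v)° = L°⟨⟨λx.t° ∣ v•·ϵ⟩⟩
-- takes one λ̄-step to L°⟨⟨v• ∣ μ̃x.t°⟩⟩ = L⟨t[x←v]⟩°, and
-- t[x←L⟨v⟩]° = L°⟨⟨v• ∣ μ̃x.t°⟩⟩ takes one μ̃-step to L⟨t{x←v}⟩°.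

sim-m : ∀ {n} {t t' : Tm n} → t →m t' → t ° →λ̄ t' °
sim-m = Cλ̄.under-eval RootM sim-root
  where
  sim-root : ∀ {k} {t t' : Tm k} → RootM t t' → t ° →λ̄ t' °
  sim-root (rm L t v) =
    subst₂ _→λ̄_
      (sym (trans (cong (_++c (v • · εₑ)) (plugL° L (val (lam t)))) (plugLC-++ L _ _)))
      (sym (trans (plugL° L _) (cong (plugLC L)
        (cong₂ ⟨_∣_⟩ (tr-renV (wkL L) v) (cong μ̃ (sym (unit-++c (t °))))))))
      (Cλ̄.under-subctx L (root (rl (t °) (renSV (wkL L) (v •)) εₑ)))

sim-e : ∀ {n} {t t' : Tm n} → t →e t' → t ° →μ̃ t' °
sim-e = Cμ̃.under-eval RootE sim-root
  where
  sim-root : ∀ {k} {t t' : Tm k} → RootE t t' → t ° →μ̃ t' °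
  sim-root (re L t v) =
    subst₂ _→μ̃_
      (sym (trans (cong (_++c μ̃ (t °)) (plugL° L (val v))) (plugLC-++ L _ _)))
      (sym (trans (plugL° L _) (cong (plugLC L)
        (trans (tr-single (renT (liftR (wkL L)) t) v)
               (cong (_[0≔ₛ v • ]) (tr-renT (liftR (wkL L)) t))))))
      (Cμ̃.under-subctx L (root (rmu (v •) (renC (liftR (wkL L)) (t °)))))

module _ {A B : Set} {R S : A → A → Set} {R' S' : B → B → Set} (f : A → B)
  (g : ∀ {x y} → R x y → R' (f x) (f y)) (h : ∀ {x y} → S x y → S' (f x) (f y)) where

  map-union : ∀ {x y} → Star (λ a b → R a b ⊎ S a b) x y →
    Star (λ a b → R' a b ⊎ S' a b) (f x) (f y)
  map-union = gmap f (Sum.map g h)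

  countˡ-map : ∀ {x y} (d : Star (λ a b → R a b ⊎ S a b) x y) →
    countˡ {R = R'} {S = S'} (map-union d) ≡ countˡ d
  countˡ-map ε            = refl
  countˡ-map (inj₁ _ ◅ d) = cong suc (countˡ-map d)
  countˡ-map (inj₂ _ ◅ d) = countˡ-map d

  countʳ-map : ∀ {x y} (d : Star (λ a b → R a b ⊎ S a b) x y) →
    countʳ {R = R'} {S = S'} (map-union d) ≡ countʳ d
  countʳ-map ε            = refl
  countʳ-map (inj₁ _ ◅ d) = countʳ-map d
  countʳ-map (inj₂ _ ◅ d) = cong suc (countʳ-map d)

len-split : ∀ {A : Set} {R S : A → A → Set} {x y : A} (d : Star (λ a b → R a b ⊎ S a b) x y) →
  len d ≡ countˡ {R = R} {S = S} d + countʳ d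
len-split ε            = refl
len-split (inj₁ _ ◅ d) = cong suc (len-split d)
len-split {R = R} {S} (inj₂ _ ◅ d) =
  trans (cong suc (len-split d)) (sym (+-suc (countˡ {R = R} {S = S} d) (countʳ d)))

simulate : ∀ {n} {t u : Tm n} → Star _→vsub_ t u → Star _→vseq_ (t °) (u °)
simulate = map-union _° sim-m sim-e

mutual
  data VarAnswer : ∀ {n} → Tm n → Set where
    va-var : ∀ {n} (x : Fin n) → VarAnswer (val (var x))
    va-es  : ∀ {n} {t : Tm (suc n)} {u : Tm n} → VarAnswer t → Inert u → VarAnswer (es t u)

  data AbsAnswer : ∀ {n} → Tm n → Set where
    aa-lam : ∀ {n} (t : Tm (suc n)) → AbsAnswer (val (lam t))
    aa-es  : ∀ {n} {t : Tm (suc n)} {u : Tm n} → AbsAnswer t → Inert u → AbsAnswer (es t u)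

  data Inert : ∀ {n} → Tm n → Set where
    in-var : ∀ {n} {t : Tm n} → VarAnswer t → (v : Val n) → Inert (app t v)
    in-app : ∀ {n} {t : Tm n} → Inert t → (v : Val n) → Inert (app t v)
    in-es  : ∀ {n} {t : Tm (suc n)} {u : Tm n} → Inert t → Inert u → Inert (es t u)

Normal : ∀ {n} → Tm n → Set
Normal t = VarAnswer t ⊎ AbsAnswer t ⊎ Inert t

IsAnswer : ∀ {n} → Tm n → Set
IsAnswer {n} t = Σ ℕ λ m → Σ (SCtx n m) λ L → Σ (Val m) λ v → t ≡ plugL L (val v)

var-answer-shape : ∀ {n} {t : Tm n} → VarAnswer t → IsAnswer t
var-answer-shape (va-var x) = _ , hole , var x , refl
var-answer-shape (va-es {u = u} a _) with var-answer-shape a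
... | m , L , v , eq = m , L [← u ] , v , cong (λ x → es x u) eq

abs-answer-shape : ∀ {n} {t : Tm n} → AbsAnswer t →
  Σ ℕ λ m → Σ (SCtx n m) λ L → Σ (Tm (suc m)) λ s → t ≡ plugL L (val (lam s))
abs-answer-shape (aa-lam t) = _ , hole , t , refl
abs-answer-shape (aa-es {u = u} a _) with abs-answer-shape a
... | m , L , s , eq = m , L [← u ] , s , cong (λ x → es x u) eq

Step : ∀ {n} → Tm n → Set
Step t = ∃ λ t' → t →vsub t'

step-under : ∀ {n k} {t : Tm n} (F : Tm n → Tm k) →
  (∀ {R : ∀ {j} → Tm j → Tm j → Set} {s s' : Tm n} → EClos R s s' → EClos R (F s) (F s')) →
  Step t → Step (F t)
step-under F ctx (t' , inj₁ s) = F t' , inj₁ (ctx s)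
step-under F ctx (t' , inj₂ s) = F t' , inj₂ (ctx s)

es-answer-step : ∀ {n} (t : Tm (suc n)) {u : Tm n} → IsAnswer u → Step (es t u)
es-answer-step t (_ , L , v , refl) = _ , inj₂ (root (re L t v))

progress : ∀ {n} (t : Tm n) → Step t ⊎ Normal t
progress (val (var x)) = inj₂ (inj₁ (va-var x))
progress (val (lam t)) = inj₂ (inj₂ (inj₁ (aa-lam t)))
progress (app t v) with progress t
... | inj₁ st                   = inj₁ (step-under (λ x → app x v) (appL v) st)
... | inj₂ (inj₁ a)             = inj₂ (inj₂ (inj₂ (in-var a v)))
... | inj₂ (inj₂ (inj₂ i))      = inj₂ (inj₂ (inj₂ (in-app i v)))
... | inj₂ (inj₂ (inj₁ a)) with abs-answer-shape a
...   | _ , L , s , refl = inj₁ (_ , inj₁ (root (rm L s v)))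
progress (es t u) with progress u
... | inj₁ st                   = inj₁ (step-under (es t) (esR t) st)
... | inj₂ (inj₁ a)             = inj₁ (es-answer-step t (var-answer-shape a))
... | inj₂ (inj₂ (inj₁ a)) with abs-answer-shape a
...   | m , L , s , eq          = inj₁ (es-answer-step t (m , L , lam s , eq))
progress (es t u) | inj₂ (inj₂ (inj₂ i)) with progress t
... | inj₁ st                   = inj₁ (step-under (λ x → es x u) (esL u) st)
... | inj₂ (inj₁ a)             = inj₂ (inj₁ (va-es a i))
... | inj₂ (inj₂ (inj₁ a))      = inj₂ (inj₂ (inj₁ (aa-es a i)))
... | inj₂ (inj₂ (inj₂ i'))     = inj₂ (inj₂ (inj₂ (in-es i' i)))

mutual
  data NormalCmd : ∀ {n} → Cmd n → Set where
    nc-lam : ∀ {n} (c : Cmd (suc n)) → NormalCmd ⟨ slam c ∣ εₑ ⟩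
    nc-var : ∀ {n} (x : Fin n) {e : Env n} → ArgEnv e → NormalCmd ⟨ svar x ∣ e ⟩

  data ArgEnv : ∀ {n} → Env n → Set where
    ae-ε    : ∀ {n} → ArgEnv {n} εₑ
    ae-cons : ∀ {n} (v : SVal n) {e : Env n} → NormalEnv e → ArgEnv (v · e)

  data NormalEnv : ∀ {n} → Env n → Set where
    ne-ε    : ∀ {n} → NormalEnv {n} εₑ
    ne-μ̃    : ∀ {n} {c : Cmd (suc n)} → NormalCmd c → NormalEnv (μ̃ c)
    ne-cons : ∀ {n} (v : SVal n) {e : Env n} → NormalEnv e → NormalEnv (v · e)

mutual
  ren-NormalCmd : ∀ {n m} (ρ : Ren n m) {c : Cmd n} → NormalCmd c → NormalCmd (renC ρ c)
  ren-NormalCmd ρ (nc-lam c)    = nc-lam _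
  ren-NormalCmd ρ (nc-var x ae) = nc-var (ρ x) (ren-ArgEnv ρ ae)

  ren-ArgEnv : ∀ {n m} (ρ : Ren n m) {e : Env n} → ArgEnv e → ArgEnv (renEnv ρ e)
  ren-ArgEnv ρ ae-ε           = ae-ε
  ren-ArgEnv ρ (ae-cons v ne) = ae-cons _ (ren-NormalEnv ρ ne)

  ren-NormalEnv : ∀ {n m} (ρ : Ren n m) {e : Env n} → NormalEnv e → NormalEnv (renEnv ρ e)
  ren-NormalEnv ρ ne-ε           = ne-ε
  ren-NormalEnv ρ (ne-μ̃ nc)      = ne-μ̃ (ren-NormalCmd (liftR ρ) nc)
  ren-NormalEnv ρ (ne-cons v ne) = ne-cons _ (ren-NormalEnv ρ ne)

plugD-NormalEnv : ∀ {n} (D : DCtx n) {e : Env n} → NormalCmd (plugD D e) → NormalEnv e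
plugD-NormalEnv (dhole _) (nc-lam c)                = ne-ε
plugD-NormalEnv (dhole _) (nc-var x ae-ε)           = ne-ε
plugD-NormalEnv (dhole _) (nc-var x (ae-cons v ne)) = ne-cons v ne
plugD-NormalEnv (dcons D v) nc with plugD-NormalEnv D nc
... | ne-cons _ ne = ne

-- A root relation with no redex at a normal command has none in any
-- closure context either: the hole under μ̃ is again a normal command.

normal-stuck : ∀ {R : ∀ {n} → Cmd n → Cmd n → Set} →
  (∀ {n} {c c' : Cmd n} → R c c' → NormalCmd c → ⊥) →
  ∀ {n} {c c' : Cmd n} → CClos R c c' → NormalCmd c → ⊥
normal-stuck root-stuck (root r) nc = root-stuck r nc
normal-stuck root-stuck (under D s) nc with plugD-NormalEnv D nc
... | ne-μ̃ nc' = normal-stuck root-stuck s nc'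

λ̄-stuck : ∀ {n} {c c' : Cmd n} → Rootλ̄ c c' → NormalCmd c → ⊥
λ̄-stuck (rl c v e) ()

μ̃-stuck : ∀ {n} {c c' : Cmd n} → Rootμ̃ c c' → NormalCmd c → ⊥
μ̃-stuck (rmu _ c) (nc-var x ())

NormalCmd-vseq : ∀ {n} {c : Cmd n} → NormalCmd c → VseqNormal c
NormalCmd-vseq nc (_ , inj₁ s) = normal-stuck λ̄-stuck s nc
NormalCmd-vseq nc (_ , inj₂ s) = normal-stuck μ̃-stuck s nc

-- Translations of normal forms, followed by a suitable environment, are
-- normal commands: a variable answer accepts an argument environment, an
-- inert term any normal environment, an abstraction answer only ϵ.

mutual
  var-answer-normal : ∀ {n} {t : Tm n} → VarAnswer t → ∀ e → ArgEnv e → NormalCmd ((t °) ++c e)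
  var-answer-normal (va-var x) e ae = nc-var x ae
  var-answer-normal (va-es {t = t} {u} a i) e ae =
    subst NormalCmd (sym (assoc-++c (u °) (μ̃ (t °)) e))
      (inert-normal i _ (ne-μ̃ (var-answer-normal a (renEnv suc e) (ren-ArgEnv suc ae))))

  inert-normal : ∀ {n} {t : Tm n} → Inert t → ∀ e → NormalEnv e → NormalCmd ((t °) ++c e)
  inert-normal (in-var {t = t} a v) e ne =
    subst NormalCmd (sym (assoc-++c (t °) (v • · εₑ) e))
      (var-answer-normal a (v • · e) (ae-cons _ ne))
  inert-normal (in-app {t = t} i v) e ne =
    subst NormalCmd (sym (assoc-++c (t °) (v • · εₑ) e))
      (inert-normal i (v • · e) (ne-cons _ ne))
  inert-normal (in-es {t = t} {u} i' i) e ne =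
    subst NormalCmd (sym (assoc-++c (u °) (μ̃ (t °)) e))
      (inert-normal i _ (ne-μ̃ (inert-normal i' (renEnv suc e) (ren-NormalEnv suc ne))))

abs-answer-normal : ∀ {n} {t : Tm n} → AbsAnswer t → NormalCmd ((t °) ++c εₑ)
abs-answer-normal (aa-lam t) = nc-lam (t °)
abs-answer-normal (aa-es {t = t} {u} a i) =
  subst NormalCmd (sym (assoc-++c (u °) (μ̃ (t °)) εₑ))
    (inert-normal i _ (ne-μ̃ (abs-answer-normal a)))

Normal-translation : ∀ {n} {t : Tm n} → Normal t → NormalCmd (t °)
Normal-translation {t = t} nf = subst NormalCmd (unit-++c (t °)) (with-ε nf)
  where
  with-ε : Normal t → NormalCmd ((t °) ++c εₑ)
  with-ε (inj₁ a)        = var-answer-normal a εₑ ae-ε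
  with-ε (inj₂ (inj₁ a)) = abs-answer-normal a
  with-ε (inj₂ (inj₂ i)) = inert-normal i εₑ ne-ε

normal-preserved : ∀ {n} (u : Tm n) → VsubNormal u → VseqNormal (u °)
normal-preserved u nrm with progress u
... | inj₁ st = λ _ → nrm st
... | inj₂ nf = NormalCmd-vseq (Normal-translation nf)

theorem4 : ∀ {n} (t u : Tm n) (d : Star _→vsub_ t u) →
    Σ (Star _→vseq_ (t °) (u °)) (λ e →
        (count-m d ≡ count-λ̄ e)
      × (count-e d ≡ count-μ̃ e)
      × (len d ≡ len e)
      × (VsubNormal u → VseqNormal (u °)))
theorem4 t u d = simulate d , m-steps , e-steps , length , normal-preserved u
  where
  m-steps : count-m d ≡ count-λ̄ (simulate d)
  m-steps = sym (countˡ-map _° sim-m sim-e d)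

  e-steps : count-e d ≡ count-μ̃ (simulate d)
  e-steps = sym (countʳ-map _° sim-m sim-e d)

  length : len d ≡ len (simulate d)
  length = begin
    len d                                             ≡⟨ len-split d ⟩
    count-m d + count-e d                             ≡⟨ cong₂ _+_ m-steps e-steps ⟩
    count-λ̄ (simulate d) + count-μ̃ (simulate d)     ≡⟨ sym (len-split (simulate d)) ⟩
    len (simulate d)                                  ∎
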